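{- Let $\kappa=p/q>0$ with $p,q$ positive integers, $s$ a positive integer, $L=s!\,q$, $\mu=1/L!$, and let $\mathcal I$ be any instance of the family described below (for any fixed permutation $\pi$). Then $\mathrm{OFF\text{ - }I}(\mathcal I)=\min\{1,\kappa\}\cdot L^2$. In particular, $\mathcal I$ is $\kappa$-undersupplied if $\kappa\ge1$ and $\kappa$-oversupplied if $\kappa\le1$.
   Context: Instance family: $S$ has $L^2$ supply nodes partitioned into $L$ types $S_1,\dots,S_L$ of $L$ nodes each; there are $T=\frac{\kappa}{\mu}L^2$ demand nodes partitioned into groups $V_1,\dots,V_L$ of $\frac{\kappa}{\mu}L$ nodes each; for a permutation $\pi$ of $[L]$, the edge set $E$ consists of all pairs $(u,t)$ with $t\in V_i$ and $u\in S_{\pi(i)}\cup\dots\cup S_{\pi(L)}$; all edges have consumption probability $\mu$. For $\kappa'>0$, $\mathrm{OFF\text{ - }I}(\mathcal I,\kappa')$ is the optimal value of maximize $\sum_{(u,t)\in E}\mu x_{u,t}$ s.t. $\sum_{t:(u,t)\in E}\mu x_{u,t}\le\kappa'$ ($u\in S$), $\sum_{u:(u,t)\in E}x_{u,t}\le1$ (each demand node $t$), $x\ge0$; $\mathrm{OFF\text{ - }I}(\mathcal I)=\mathrm{OFF\text{ - }I}(\mathcal I,1)$. An instance is $\kappa$-undersupplied if $\kappa=\max\{\bar\kappa\ge1:\mathrm{OFF\text{ - }I}(\mathcal I,\bar\kappa)=\bar\kappa\,\mathrm{OFF\text{ - }I}(\mathcal I)\}$ and $\kappa$-oversupplied if $\kappa=\min\{\bar\kappa\le1:\mathrm{OFF\text{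 - }I}(\mathcal I,\bar\kappa)=\mathrm{OFF\text{ - }I}(\mathcal I)\}$.
   Formalization: The LP variables $x_{u,t}$, the capacity $\kappa'$ and the parameter $\bar\kappa$ in the max and min defining under- and oversupply range over the rationals. -}

module Defs where

open import Data.Nat as ℕ using (ℕ; zero; suc; NonZero; _!)
open import Data.Nat.Properties using (_!≢0)
open import Data.Integer using (+_)
open import Data.Fin using (Fin)
import Data.Fin as Fin
open import Data.Fin.Permutation using (Permutation′; _⟨$⟩ʳ_)
open import Data.Product using (Σ; ∃; _×_; _,_)
open import Relation.Binary.PropositionalEquality using (_≡_)
open import Relation.Nullary using (¬_)
open import Data.Rational using (ℚ; 0ℚ; 1ℚ; _+_; _*_; _≤_; _<_; _/_)

sumFin : (n : ℕ) → (Fin n → ℚ) → ℚ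
sumFin zero    f = 0ℚ
sumFin (suc n) f = f Fin.zero + sumFin n (λ i → f (Fin.suc i))

ℕ→ℚ : ℕ → ℚ
ℕ→ℚ n = + n / 1

-- Generic instance of the family with L types, groups V_i of size M,
-- consumption probability μ, and permutation π of [L] (0-indexed).
-- Supply node (a , j) : the j-th node of type S_a.
-- Demand node (i , k) : the k-th node of group V_i.
Supply : ℕ → Set
Supply L = Fin L × Fin L

Demand : ℕ → ℕ → Set
Demand L M = Fin L × Fin M

-- (u , t) ∈ E  iff  t ∈ V_i and u ∈ S_{π(i)} ∪ … ∪ S_{π(L)},
-- i.e. the type a of u equals π(i') for some i' ≥ i.
Edge : (L M : ℕ) → Permutation′ L → Supply L → Demand L M → Set
Edge L M π (a , j) (i , k) = Σ (Fin L) λ i' → (i Fin.≤ i') × (π ⟨$⟩ʳ i' ≡ a)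

-- A fractional assignment: x is defined on all pairs but forced to be 0
-- off the edge set (equivalent to having variables only on E).
Assignment : ℕ → ℕ → Set
Assignment L M = Supply L → Demand L M → ℚ

sumDemand : (L M : ℕ) → (Demand L M → ℚ) → ℚ
sumDemand L M f = sumFin L λ i → sumFin M λ k → f (i , k)

sumSupply : (L : ℕ) → (Supply L → ℚ) → ℚ
sumSupply L f = sumFin L λ a → sumFin L λ j → f (a , j)

Feasible : (L M : ℕ) (μ : ℚ) (π : Permutation′ L) (κ' : ℚ) → Assignment L M → Set
Feasible L M μ π κ' x =
    (∀ u t → 0ℚ ≤ x u t)
  × (∀ u t → ¬ Edge L M π u t → x u t ≡ 0ℚ)
  × (∀ u → sumDemand L M (λ t → μ * x u t) ≤ κ')
  × (∀ t → sumSupply L (λ u → x u t) ≤ 1ℚ)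

objective : (L M : ℕ) (μ : ℚ) → Assignment L M → ℚ
objective L M μ x = sumSupply L λ u → sumDemand L M λ t → μ * x u t

IsOFFI : (L M : ℕ) (μ : ℚ) (π : Permutation′ L) (κ' : ℚ) (v : ℚ) → Set
IsOFFI L M μ π κ' v =
    (∃ λ x → Feasible L M μ π κ' x × objective L M μ x ≡ v)
  × (∀ x → Feasible L M μ π κ' x → objective L M μ x ≤ v)

-- κ-undersupplied: κ = max{κ̄ ≥ 1 : OFF-I(I,κ̄) = κ̄ · OFF-I(I)}
Undersupplied : (L M : ℕ) (μ : ℚ) (π : Permutation′ L) (κ : ℚ) → Set
Undersupplied L M μ π κ =
  1ℚ ≤ κ × (∃ λ v₁ → IsOFFI L M μ π 1ℚ v₁ × IsOFFI L M μ π κ (κ * v₁)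
     × (∀ κ̄ → 1ℚ ≤ κ̄ → ∀ w → IsOFFI L M μ π κ̄ w → w ≡ κ̄ * v₁ → κ̄ ≤ κ))

-- κ-oversupplied: κ = min{0 < κ̄ ≤ 1 : OFF-I(I,κ̄) = OFF-I(I)}
Oversupplied : (L M : ℕ) (μ : ℚ) (π : Permutation′ L) (κ : ℚ) → Set
Oversupplied L M μ π κ =
  κ ≤ 1ℚ × (∃ λ v₁ → IsOFFI L M μ π 1ℚ v₁ × IsOFFI L M μ π κ v₁
     × (∀ κ̄ → 0ℚ < κ̄ → κ̄ ≤ 1ℚ → ∀ w → IsOFFI L M μ π κ̄ w → w ≡ v₁ → κ ≤ κ̄))

-- Parameters of the lemma: L = s! q, μ = 1/L!, |V_i| = (κ/μ) L = p · L! · L / q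
-- (exact division since q ∣ L ∣ L!).
Lpar : (q s : ℕ) → ℕ
Lpar q s = s ! ℕ.* q

μpar : (L : ℕ) → ℚ
μpar L = _/_ (+ 1) (L !) {{L !≢0}}

groupSize : (p q L : ℕ) → .{{NonZero q}} → ℕ
groupSize p q L = (p ℕ.* L ! ℕ.* L) ℕ./ q

-- Each of the L² supply nodes ships at most κ′ and each of the L |V_i| demand nodes absorbs at
-- most μ, so OFF-I(κ′) ≤ min(κ′ L², μ |V_i| L) = min(κ′, κ) L², since the parameters are chosen
-- with μ |V_i| = κ L. The bound is attained by serving each group V_i only from the adjacent type
-- S_{π(i)}, uniformly. Thus OFF-I(κ′) = min(κ′, κ) L², which equals κ′ · OFF-I exactly for
-- κ′ ≤ κ and equals OFF-I exactly for κ′ ≥ κ.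

module Submission where

open import Defs
open import Data.Nat using (ℕ; NonZero)
open import Data.Integer using (+_)
open import Data.Fin.Permutation using (Permutation′)
open import Data.Product using (_×_)
open import Data.Rational using (ℚ; 1ℚ; _*_; _≤_; _⊓_; _/_)

open import Data.Nat as ℕ using (zero; suc; _!)
open import Data.Nat.Properties as ℕ using (_!≢0)
open import Data.Nat.DivMod using (m*n/n≡m)
import Data.Nat.Tactic.RingSolver as ℕ
import Data.Integer as ℤ
import Data.Integer.Properties as ℤ
open import Data.Fin using (Fin; zero; suc; _≟_)
import Data.Fin.Properties as Fin
open import Data.Fin.Permutation using (_⟨$⟩ʳ_; _⟨$⟩ˡ_; inverseʳ; inverseˡ)
open import Data.Bool using (true; false; if_then_else_)
open import Data.Product using (_,_; proj₁)
open import Data.Rational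
  using (0ℚ; _+_; _<_; 1/_; Positive; NonNegative; nonNegative; toℚᵘ)
open import Data.Rational.Properties hiding (_≟_)
open import Data.Rational.Solver using (module +-*-Solver)
import Data.Rational as ℚ
import Data.Rational.Unnormalised as ℚᵘ
import Data.Rational.Unnormalised.Properties as ℚᵘ
open import Algebra.Bundles using (Ring)
open import Algebra.Properties.Semiring.Sum (Ring.semiring +-*-ring)
  using (sum; sum-cong-≗; ∑-comm; *-distribˡ-sum)
open import Function using (_∘_)
open import Relation.Binary.PropositionalEquality
open import Relation.Nullary using (does)
open import Relation.Nullary.Decidable using (dec-true; dec-false)

ℕ→ℚ≃ : ∀ n → toℚᵘ (ℕ→ℚ n) ℚᵘ.≃ ℚᵘ.mkℚᵘ (+ n) 0
ℕ→ℚ≃ n = toℚᵘ-fromℚᵘ (ℚᵘ.mkℚᵘ (+ n) 0)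

ℕ→ℚ-nonNeg : ∀ n → NonNegative (ℕ→ℚ n)
ℕ→ℚ-nonNeg n = normalize-nonNeg n 1

ℕ→ℚ-pos : ∀ n .{{_ : NonZero n}} → Positive (ℕ→ℚ n)
ℕ→ℚ-pos n = normalize-pos n 1

ℕ→ℚ-suc : ∀ n → ℕ→ℚ (suc n) ≡ 1ℚ + ℕ→ℚ n
ℕ→ℚ-suc n = toℚᵘ-injective (begin
  toℚᵘ (ℕ→ℚ (suc n))                         ≈⟨ ℕ→ℚ≃ (suc n) ⟩
  ℚᵘ.mkℚᵘ (+ suc n) 0                         ≈⟨ ℚᵘ.*≡* cross ⟩
  ℚᵘ.1ℚᵘ ℚᵘ.+ ℚᵘ.mkℚᵘ (+ n) 0                 ≈⟨ ℚᵘ.+-congʳ ℚᵘ.1ℚᵘ (ℕ→ℚ≃ n) ⟨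
  toℚᵘ 1ℚ ℚᵘ.+ toℚᵘ (ℕ→ℚ n)                  ≈⟨ toℚᵘ-homo-+ 1ℚ (ℕ→ℚ n) ⟨
  toℚᵘ (1ℚ + ℕ→ℚ n)                           ∎)
  where
  open ℚᵘ.≃-Reasoning
  cross : + suc n ℤ.* + 1 ≡ (+ 1 ℤ.* + 1 ℤ.+ + n ℤ.* + 1) ℤ.* + 1
  cross = cong (λ i → (+ 1 ℤ.+ i) ℤ.* + 1) (sym (ℤ.*-identityʳ (+ n)))

/-*-ℕ→ℚ : ∀ a b c d .{{_ : NonZero b}} → a ℕ.* c ≡ d ℕ.* b → (+ a / b) * ℕ→ℚ c ≡ ℕ→ℚ d
/-*-ℕ→ℚ a b@(suc b-1) c d ac≡db = toℚᵘ-injective (begin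
  toℚᵘ (+ a / b * ℕ→ℚ c)                      ≈⟨ toℚᵘ-homo-* (+ a / b) (ℕ→ℚ c) ⟩
  toℚᵘ (+ a / b) ℚᵘ.* toℚᵘ (ℕ→ℚ c)            ≈⟨ ℚᵘ.*-cong (toℚᵘ-fromℚᵘ (ℚᵘ.mkℚᵘ (+ a) b-1)) (ℕ→ℚ≃ c) ⟩
  ℚᵘ.mkℚᵘ (+ a) b-1 ℚᵘ.* ℚᵘ.mkℚᵘ (+ c) 0      ≈⟨ ℚᵘ.*≡* cross ⟩
  ℚᵘ.mkℚᵘ (+ d) 0                             ≈⟨ ℕ→ℚ≃ d ⟨
  toℚᵘ (ℕ→ℚ d)                                ∎)
  where
  open ℚᵘ.≃-Reasoning
  cross : (+ a ℤ.* + c) ℤ.* + 1 ≡ + d ℤ.* (+ b ℤ.* + 1)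
  cross = trans (ℤ.*-identityʳ _) (trans (sym (ℤ.pos-* a c)) (trans (cong +_ ac≡db)
            (trans (ℤ.pos-* d b) (cong (ℤ._*_ (+ d)) (sym (ℤ.*-identityʳ (+ b)))))))

ℕ→ℚ-* : ∀ m n → ℕ→ℚ (m ℕ.* n) ≡ ℕ→ℚ m * ℕ→ℚ n
ℕ→ℚ-* m n = sym (/-*-ℕ→ℚ m 1 n (m ℕ.* n) (sym (ℕ.*-identityʳ (m ℕ.* n))))

sumFin-syntax : ∀ n → (Fin n → ℚ) → ℚ
sumFin-syntax = sumFin

infix 5 sumFin-syntax
syntax sumFin-syntax n (λ i → x) = ∑[ i < n ] x

sumFin≡sum : ∀ n (f : Fin n → ℚ) → sumFin n f ≡ sum f
sumFin≡sum zero    f = refl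
sumFin≡sum (suc n) f = cong (_+_ (f zero)) (sumFin≡sum n (f ∘ suc))

sumFin-cong : ∀ n {f g : Fin n → ℚ} → f ≗ g → sumFin n f ≡ sumFin n g
sumFin-cong n {f} {g} f≗g =
  trans (sumFin≡sum n f) (trans (sum-cong-≗ f≗g) (sym (sumFin≡sum n g)))

sumFin-mono : ∀ n {f g : Fin n → ℚ} → (∀ i → f i ≤ g i) → sumFin n f ≤ sumFin n g
sumFin-mono zero    f≤g = ≤-refl
sumFin-mono (suc n) f≤g = +-mono-≤ (f≤g zero) (sumFin-mono n (f≤g ∘ suc))

sumFin-comm : ∀ m n (f : Fin m → Fin n → ℚ) →
              sumFin m (λ i → sumFin n (f i)) ≡ sumFin n (λ j → sumFin m (λ i → f i j))
sumFin-comm m n f = begin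
  sumFin m (λ i → sumFin n (f i))           ≡⟨ sumFin-cong m (λ i → sumFin≡sum n (f i)) ⟩
  sumFin m (λ i → sum (f i))                ≡⟨ sumFin≡sum m _ ⟩
  sum (λ i → sum (f i))                     ≡⟨ ∑-comm f ⟩
  sum (λ j → sum (λ i → f i j))             ≡⟨ sumFin≡sum n _ ⟨
  sumFin n (λ j → sum (λ i → f i j))        ≡⟨ sumFin-cong n (λ j → sumFin≡sum m (λ i → f i j)) ⟨
  sumFin n (λ j → sumFin m (λ i → f i j))   ∎
  where open ≡-Reasoning

*-distribˡ-sumFin : ∀ n c (f : Fin n → ℚ) → c * sumFin n f ≡ sumFin n (λ i → c * f i)
*-distribˡ-sumFin n c f = begin
  c * sumFin n f            ≡⟨ cong (c *_) (sumFin≡sum n f) ⟩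
  c * sum f                 ≡⟨ *-distribˡ-sum c f ⟩
  sum (λ i → c * f i)       ≡⟨ sumFin≡sum n _ ⟨
  sumFin n (λ i → c * f i)  ∎
  where open ≡-Reasoning

sumFin-const : ∀ n c → sumFin n (λ _ → c) ≡ ℕ→ℚ n * c
sumFin-const zero    c = sym (*-zeroˡ c)
sumFin-const (suc n) c = begin
  c + sumFin n (λ _ → c)   ≡⟨ cong₂ _+_ (sym (*-identityˡ c)) (sumFin-const n c) ⟩
  1ℚ * c + ℕ→ℚ n * c       ≡⟨ *-distribʳ-+ c 1ℚ (ℕ→ℚ n) ⟨
  (1ℚ + ℕ→ℚ n) * c         ≡⟨ cong (λ r → r * c) (ℕ→ℚ-suc n) ⟨
  ℕ→ℚ (suc n) * c          ∎
  where open ≡-Reasoning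

sumFin-zero : ∀ n {f : Fin n → ℚ} → (∀ i → f i ≡ 0ℚ) → sumFin n f ≡ 0ℚ
sumFin-zero n f≡0 = trans (sumFin-cong n f≡0) (trans (sumFin-const n 0ℚ) (*-zeroʳ (ℕ→ℚ n)))

sumFin-single : ∀ n (f : Fin n → ℚ) i → (∀ j → j ≢ i → f j ≡ 0ℚ) → sumFin n f ≡ f i
sumFin-single (suc n) f zero f≡0 = begin
  f zero + sumFin n (f ∘ suc)   ≡⟨ cong (_+_ (f zero)) (sumFin-zero n (λ j → f≡0 (suc j) λ ())) ⟩
  f zero + 0ℚ                   ≡⟨ +-identityʳ (f zero) ⟩
  f zero                        ∎
  where open ≡-Reasoning
sumFin-single (suc n) f (suc i) f≡0 = begin
  f zero + sumFin n (f ∘ suc)   ≡⟨ cong (λ r → r + sumFin n (f ∘ suc)) (f≡0 zero λ ()) ⟩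
  0ℚ + sumFin n (f ∘ suc)       ≡⟨ +-identityˡ _ ⟩
  sumFin n (f ∘ suc)            ≡⟨ sumFin-single n (f ∘ suc) i (λ j j≢i → f≡0 (suc j) (j≢i ∘ Fin.suc-injective)) ⟩
  f (suc i)                     ∎
  where open ≡-Reasoning

sumFin²-const : ∀ m n c → sumFin m (λ _ → sumFin n (λ _ → c)) ≡ ℕ→ℚ (m ℕ.* n) * c
sumFin²-const m n c = begin
  sumFin m (λ _ → sumFin n (λ _ → c))   ≡⟨ sumFin-cong m (λ _ → sumFin-const n c) ⟩
  sumFin m (λ _ → ℕ→ℚ n * c)            ≡⟨ sumFin-const m (ℕ→ℚ n * c) ⟩
  ℕ→ℚ m * (ℕ→ℚ n * c)                   ≡⟨ *-assoc (ℕ→ℚ m) (ℕ→ℚ n) c ⟨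
  ℕ→ℚ m * ℕ→ℚ n * c                     ≡⟨ cong (λ r → r * c) (ℕ→ℚ-* m n) ⟨
  ℕ→ℚ (m ℕ.* n) * c                     ∎
  where open ≡-Reasoning

sumSupply-sumDemand-comm : ∀ L M (f : Supply L → Demand L M → ℚ) →
  sumSupply L (λ u → sumDemand L M (f u)) ≡ sumDemand L M (λ t → sumSupply L (λ u → f u t))
sumSupply-sumDemand-comm L M f = begin
  ∑[ a < L ] ∑[ j < L ] ∑[ i < L ] ∑[ k < M ] f (a , j) (i , k)
    ≡⟨ sumFin-cong L (λ a → sumFin-comm L L (λ j i → ∑[ k < M ] f (a , j) (i , k))) ⟩
  ∑[ a < L ] ∑[ i < L ] ∑[ j < L ] ∑[ k < M ] f (a , j) (i , k)
    ≡⟨ sumFin-comm L L (λ a i → ∑[ j < L ] ∑[ k < M ] f (a , j) (i , k)) ⟩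
  ∑[ i < L ] ∑[ a < L ] ∑[ j < L ] ∑[ k < M ] f (a , j) (i , k)
    ≡⟨ sumFin-cong L (λ i → sumFin-cong L (λ a → sumFin-comm L M (λ j k → f (a , j) (i , k)))) ⟩
  ∑[ i < L ] ∑[ a < L ] ∑[ k < M ] ∑[ j < L ] f (a , j) (i , k)
    ≡⟨ sumFin-cong L (λ i → sumFin-comm L M (λ a k → ∑[ j < L ] f (a , j) (i , k))) ⟩
  ∑[ i < L ] ∑[ k < M ] ∑[ a < L ] ∑[ j < L ] f (a , j) (i , k)
    ∎
  where open ≡-Reasoning

module FamilyInstance (L M : ℕ) .{{_ : NonZero L}} (μ κ : ℚ) .{{_ : Positive κ}} (π : Permutation′ L)
         (μ≥0 : 0ℚ ≤ μ) (μM≡κL : μ * ℕ→ℚ M ≡ κ * ℕ→ℚ L) where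

  private
    L² : ℚ
    L² = ℕ→ℚ (L ℕ.* L)

    κL : ℚ
    κL = κ * ℕ→ℚ L

    instance
      L²-pos : Positive L²
      L²-pos = ℕ→ℚ-pos (L ℕ.* L) {{ℕ.m*n≢0 L L}}

      L²-nonNeg : NonNegative L²
      L²-nonNeg = pos⇒nonNeg L²

      κL-pos : Positive κL
      κL-pos = pos*pos⇒pos κ (ℕ→ℚ L) {{ℕ→ℚ-pos L}}

      κL≢0 : ℚ.NonZero κL
      κL≢0 = pos⇒nonZero κL

      1/κL-nonNeg : NonNegative (1/ κL)
      1/κL-nonNeg = pos⇒nonNeg (1/ κL) {{1/pos⇒pos κL}}

    κ≥0 : 0ℚ ≤ κ
    κ≥0 = nonNegative⁻¹ κ {{pos⇒nonNeg κ}}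

  supply-bound : ∀ {κ′} x → Feasible L M μ π κ′ x → objective L M μ x ≤ κ′ * L²
  supply-bound {κ′} x (_ , _ , supply≤κ′ , _) = begin
    objective L M μ x                  ≤⟨ sumFin-mono L (λ a → sumFin-mono L (λ j → supply≤κ′ (a , j))) ⟩
    ∑[ a < L ] ∑[ j < L ] κ′           ≡⟨ sumFin²-const L L κ′ ⟩
    L² * κ′                            ≡⟨ *-comm L² κ′ ⟩
    κ′ * L²                            ∎
    where open ≤-Reasoning

  demand-bound : ∀ {κ′} x → Feasible L M μ π κ′ x → objective L M μ x ≤ κ * L²
  demand-bound x (_ , _ , _ , demand≤1) = begin
    objective L M μ x
      ≡⟨ sumSupply-sumDemand-comm L M (λ u t → μ * x u t) ⟩
    sumDemand L M (λ t → sumSupply L (λ u → μ * x u t))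
      ≡⟨ sumFin-cong L (λ i → sumFin-cong M (λ k → *-distribˡ-sumSupply (i , k))) ⟨
    sumDemand L M (λ t → μ * sumSupply L (λ u → x u t))
      ≤⟨ sumFin-mono L (λ i → sumFin-mono M (λ k → *-monoˡ-≤-nonNeg μ {{nonNegative μ≥0}} (demand≤1 (i , k)))) ⟩
    sumDemand L M (λ _ → μ * 1ℚ)
      ≡⟨ sumFin²-const L M (μ * 1ℚ) ⟩
    ℕ→ℚ (L ℕ.* M) * (μ * 1ℚ)
      ≡⟨ cong (λ r → r * (μ * 1ℚ)) (ℕ→ℚ-* L M) ⟩
    ℕ→ℚ L * ℕ→ℚ M * (μ * 1ℚ)
      ≡⟨ solve 3 (λ l m μ → l :* m :* (μ :* con 1ℚ) := l :* (μ :* m)) refl (ℕ→ℚ L) (ℕ→ℚ M) μ ⟩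
    ℕ→ℚ L * (μ * ℕ→ℚ M)
      ≡⟨ cong (ℕ→ℚ L *_) μM≡κL ⟩
    ℕ→ℚ L * (κ * ℕ→ℚ L)
      ≡⟨ solve 2 (λ l κ → l :* (κ :* l) := κ :* (l :* l)) refl (ℕ→ℚ L) κ ⟩
    κ * (ℕ→ℚ L * ℕ→ℚ L)
      ≡⟨ cong (κ *_) (ℕ→ℚ-* L L) ⟨
    κ * L²
      ∎
    where
    open ≤-Reasoning
    open +-*-Solver
    *-distribˡ-sumSupply : ∀ t → μ * sumSupply L (λ u → x u t) ≡ sumSupply L (λ u → μ * x u t)
    *-distribˡ-sumSupply t = trans (*-distribˡ-sumFin L μ _)
      (sumFin-cong L (λ a → *-distribˡ-sumFin L μ (λ j → x (a , j) t)))

  module MatchingAssignment (κ′ : ℚ) (κ′≥0 : 0ℚ ≤ κ′) where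

    weight : ℚ
    weight = 1/ κL * (κ′ ⊓ κ)

    x : Assignment L M
    x (a , _) (i , _) = if does (π ⟨$⟩ʳ i ≟ a) then weight else 0ℚ

    x-matched : ∀ u t → π ⟨$⟩ʳ proj₁ t ≡ proj₁ u → x u t ≡ weight
    x-matched (a , _) (i , _) πi≡a = cong (λ b → if b then weight else 0ℚ) (dec-true (π ⟨$⟩ʳ i ≟ a) πi≡a)

    x-unmatched : ∀ u t → π ⟨$⟩ʳ proj₁ t ≢ proj₁ u → x u t ≡ 0ℚ
    x-unmatched (a , _) (i , _) πi≢a = cong (λ b → if b then weight else 0ℚ) (dec-false (π ⟨$⟩ʳ i ≟ a) πi≢a)

    weight≥0 : 0ℚ ≤ weight
    weight≥0 = nonNegative⁻¹ weight {{nonNeg*nonNeg⇒nonNeg (1/ κL) (κ′ ⊓ κ) {{nonNegative (⊓-glb κ′≥0 κ≥0)}}}}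

    x≥0 : ∀ u t → 0ℚ ≤ x u t
    x≥0 (a , _) (i , _) with does (π ⟨$⟩ʳ i ≟ a)
    ... | true  = weight≥0
    ... | false = ≤-refl

    supply-load : ∀ u → sumDemand L M (λ t → μ * x u t) ≡ κ′ ⊓ κ
    supply-load (a , j) = begin
      sumDemand L M (λ t → μ * x (a , j) t)
        ≡⟨ sumFin-single L _ (π ⟨$⟩ˡ a) (λ i i≢π⁻¹a → sumFin-zero M (λ k →
             trans (cong (μ *_) (x-unmatched (a , j) (i , k) (λ πi≡a → i≢π⁻¹a (trans (sym (inverseˡ π)) (cong (π ⟨$⟩ˡ_) πi≡a)))))
                   (*-zeroʳ μ))) ⟩
      ∑[ k < M ] μ * x (a , j) (π ⟨$⟩ˡ a , k)
        ≡⟨ sumFin-cong M (λ k → cong (μ *_) (x-matched (a , j) (π ⟨$⟩ˡ a , k) (inverseʳ π))) ⟩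
      ∑[ k < M ] μ * weight
        ≡⟨ sumFin-const M (μ * weight) ⟩
      ℕ→ℚ M * (μ * (1/ κL * (κ′ ⊓ κ)))
        ≡⟨ solve 4 (λ m μ r c → m :* (μ :* (r :* c)) := μ :* m :* r :* c) refl (ℕ→ℚ M) μ (1/ κL) (κ′ ⊓ κ) ⟩
      μ * ℕ→ℚ M * 1/ κL * (κ′ ⊓ κ)
        ≡⟨ cong (λ r → r * 1/ κL * (κ′ ⊓ κ)) μM≡κL ⟩
      κL * 1/ κL * (κ′ ⊓ κ)
        ≡⟨ cong (λ r → r * (κ′ ⊓ κ)) (*-inverseʳ κL) ⟩
      1ℚ * (κ′ ⊓ κ)
        ≡⟨ *-identityˡ (κ′ ⊓ κ) ⟩
      κ′ ⊓ κ
        ∎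
      where
      open ≡-Reasoning
      open +-*-Solver

    demand-load : ∀ t → sumSupply L (λ u → x u t) ≡ ℕ→ℚ L * weight
    demand-load (i , k) = begin
      sumSupply L (λ u → x u (i , k))
        ≡⟨ sumFin-single L _ (π ⟨$⟩ʳ i) (λ a a≢πi → sumFin-zero L (λ j → x-unmatched (a , j) (i , k) (a≢πi ∘ sym))) ⟩
      ∑[ j < L ] x (π ⟨$⟩ʳ i , j) (i , k)
        ≡⟨ sumFin-cong L (λ j → x-matched (π ⟨$⟩ʳ i , j) (i , k) refl) ⟩
      ∑[ j < L ] weight
        ≡⟨ sumFin-const L weight ⟩
      ℕ→ℚ L * weight
        ∎
      where open ≡-Reasoning

    L*weight≤1 : ℕ→ℚ L * weight ≤ 1ℚ
    L*weight≤1 = begin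
      ℕ→ℚ L * (1/ κL * (κ′ ⊓ κ))
        ≤⟨ *-monoˡ-≤-nonNeg (ℕ→ℚ L) {{ℕ→ℚ-nonNeg L}}
             (*-monoˡ-≤-nonNeg (1/ κL) (p⊓q≤q κ′ κ)) ⟩
      ℕ→ℚ L * (1/ κL * κ)
        ≡⟨ solve 3 (λ l r κ → l :* (r :* κ) := (κ :* l) :* r) refl (ℕ→ℚ L) (1/ κL) κ ⟩
      κL * 1/ κL
        ≡⟨ *-inverseʳ κL ⟩
      1ℚ
        ∎
      where
      open ≤-Reasoning
      open +-*-Solver

    feasible : Feasible L M μ π κ′ x
    feasible = x≥0
             , (λ u t ¬edge → x-unmatched u t (λ πi≡a → ¬edge (_ , Fin.≤-refl , πi≡a)))
             , (λ u → ≤-trans (≤-reflexive (supply-load u)) (p⊓q≤p κ′ κ))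
             , (λ t → ≤-trans (≤-reflexive (demand-load t)) L*weight≤1)

    objective-x : objective L M μ x ≡ (κ′ ⊓ κ) * L²
    objective-x = begin
      objective L M μ x              ≡⟨ sumFin-cong L (λ a → sumFin-cong L (λ j → supply-load (a , j))) ⟩
      ∑[ a < L ] ∑[ j < L ] κ′ ⊓ κ   ≡⟨ sumFin²-const L L (κ′ ⊓ κ) ⟩
      L² * (κ′ ⊓ κ)                  ≡⟨ *-comm L² (κ′ ⊓ κ) ⟩
      (κ′ ⊓ κ) * L²                  ∎
      where open ≡-Reasoning

  OFF-I-value : ∀ κ′ → 0ℚ ≤ κ′ → IsOFFI L M μ π κ′ ((κ′ ⊓ κ) * L²)
  OFF-I-value κ′ κ′≥0 = (x , feasible , objective-x) , λ y y-feasible → begin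
    objective L M μ y    ≤⟨ ⊓-glb (supply-bound y y-feasible) (demand-bound y y-feasible) ⟩
    (κ′ * L²) ⊓ (κ * L²) ≡⟨ *-distribʳ-⊓-nonNeg L² κ′ κ ⟨
    (κ′ ⊓ κ) * L²        ∎
    where
    open MatchingAssignment κ′ κ′≥0
    open ≤-Reasoning

  private
    OFF-I-value-at-κ : IsOFFI L M μ π κ (κ * L²)
    OFF-I-value-at-κ = subst (IsOFFI L M μ π κ) (cong (_* L²) (⊓-idem κ)) (OFF-I-value κ κ≥0)

  undersupplied : 1ℚ ≤ κ → Undersupplied L M μ π κ
  undersupplied 1≤κ = 1≤κ , v₁ , OFF-I-value 1ℚ (nonNegative⁻¹ 1ℚ)
                    , subst (IsOFFI L M μ π κ) (cong (κ *_) (sym v₁≡L²)) OFF-I-value-at-κ , maximal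
    where
    v₁ : ℚ
    v₁ = (1ℚ ⊓ κ) * L²

    v₁≡L² : v₁ ≡ L²
    v₁≡L² = trans (cong (_* L²) (p≤q⇒p⊓q≡p 1≤κ)) (*-identityˡ L²)

    maximal : ∀ κ̄ → 1ℚ ≤ κ̄ → ∀ w → IsOFFI L M μ π κ̄ w → w ≡ κ̄ * v₁ → κ̄ ≤ κ
    maximal κ̄ _ w ((y , y-feasible , objective-y≡w) , _) w≡κ̄v₁ = *-cancelʳ-≤-pos L² (begin
      κ̄ * L²              ≡⟨ trans w≡κ̄v₁ (cong (κ̄ *_) v₁≡L²) ⟨
      w                   ≡⟨ objective-y≡w ⟨
      objective L M μ y   ≤⟨ demand-bound y y-feasible ⟩
      κ * L²              ∎)
      where open ≤-Reasoning

  oversupplied : κ ≤ 1ℚ → Oversupplied L M μ π κ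
  oversupplied κ≤1 = κ≤1 , v₁ , OFF-I-value 1ℚ (nonNegative⁻¹ 1ℚ)
                   , subst (IsOFFI L M μ π κ) (sym v₁≡κL²) OFF-I-value-at-κ , minimal
    where
    v₁ : ℚ
    v₁ = (1ℚ ⊓ κ) * L²

    v₁≡κL² : v₁ ≡ κ * L²
    v₁≡κL² = cong (_* L²) (p≥q⇒p⊓q≡q κ≤1)

    minimal : ∀ κ̄ → 0ℚ < κ̄ → κ̄ ≤ 1ℚ → ∀ w → IsOFFI L M μ π κ̄ w → w ≡ v₁ → κ ≤ κ̄
    minimal κ̄ _ _ w ((y , y-feasible , objective-y≡w) , _) w≡v₁ = *-cancelʳ-≤-pos L² (begin
      κ * L²              ≡⟨ trans w≡v₁ v₁≡κL² ⟨
      w                   ≡⟨ objective-y≡w ⟨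
      objective L M μ y   ≤⟨ supply-bound y y-feasible ⟩
      κ̄ * L²              ∎)
      where open ≤-Reasoning

groupSize≡ : ∀ p q s .{{_ : NonZero q}} → groupSize p q (Lpar q s) ≡ p ℕ.* Lpar q s ! ℕ.* s !
groupSize≡ p q s = trans (cong (ℕ._/ q) (sym (ℕ.*-assoc (p ℕ.* L !) (s !) q))) (m*n/n≡m (p ℕ.* L ! ℕ.* s !) q)
  where
  L : ℕ
  L = Lpar q s

μ*groupSize≡κ*L : ∀ p q s .{{_ : NonZero q}} →
  μpar (Lpar q s) * ℕ→ℚ (groupSize p q (Lpar q s)) ≡ (+ p / q) * ℕ→ℚ (Lpar q s)
μ*groupSize≡κ*L p q s = begin
  μpar L * ℕ→ℚ (groupSize p q L)      ≡⟨ cong (λ m → μpar L * ℕ→ℚ m) (groupSize≡ p q s) ⟩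
  μpar L * ℕ→ℚ (p ℕ.* L ! ℕ.* s !)    ≡⟨ /-*-ℕ→ℚ 1 (L !) _ (p ℕ.* s !) {{L !≢0}} (rearrange p (L !) (s !)) ⟩
  ℕ→ℚ (p ℕ.* s !)                     ≡⟨ /-*-ℕ→ℚ p q L (p ℕ.* s !) (sym (ℕ.*-assoc p (s !) q)) ⟨
  (+ p / q) * ℕ→ℚ L                   ∎
  where
  open ≡-Reasoning
  L : ℕ
  L = Lpar q s
  rearrange : ∀ p a b → 1 ℕ.* (p ℕ.* a ℕ.* b) ≡ p ℕ.* b ℕ.* a
  rearrange = ℕ.solve-∀

lemma10 : (p q : ℕ) → .{{_ : NonZero p}} → .{{_ : NonZero q}} → (s : ℕ) → .{{_ : NonZero s}}
  → (π : Permutation′ (Lpar q s))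
  → let L = Lpar q s
        M = groupSize p q L
        μ = μpar L
        κ = + p / q
    in IsOFFI L M μ π 1ℚ ((1ℚ ⊓ κ) * ℕ→ℚ (L Data.Nat.* L))
       × (1ℚ ≤ κ → Undersupplied L M μ π κ)
       × (κ ≤ 1ℚ → Oversupplied L M μ π κ)
lemma10 p q s π = OFF-I-value 1ℚ (nonNegative⁻¹ 1ℚ) , undersupplied , oversupplied
  where
  L : ℕ
  L = Lpar q s

  instance
    L≢0 : NonZero L
    L≢0 = ℕ.m*n≢0 (s !) q {{s !≢0}}

    κ-pos : Positive (+ p / q)
    κ-pos = normalize-pos p q

  μ≥0 : 0ℚ ≤ μpar L
  μ≥0 = nonNegative⁻¹ (μpar L) {{normalize-nonNeg 1 (L !) {{L !≢0}}}}

  open FamilyInstance L (groupSize p q L) (μpar L) (+ p / q) π μ≥0 (μ*groupSize≡κ*L p q s)
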